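{- Let $t\ge 1$ be an odd integer, $i\ge 2$ an integer, and $n$ an integer with $2n=t(t+i)$. Then the complete bipartite graph $K_{n,n}$ has no equitable $(t,\infty,2)$-tree-coloring.
   Context: A $t$-coloring of a graph $G$ is a map $f:V(G)\to\{1,\dots,t\}$ (not necessarily surjective); its color classes are $V_j=f^{ -1}(j)$. It is equitable if $||V_j|-|V_l||\le 1$ for all $j,l$. It is a $(t,\infty,2)$-tree-coloring if for every $j$, each connected component of $G[V_j]$ is a tree of diameter at most $2$ (no restriction on maximum degree). -}

module Defs where

open import Data.Nat using (ℕ; _+_; _<_; _≤_; _≥_; _<?_)
open import Data.Fin using (Fin; toℕ; _≟_)
open import Data.List using (List; []; _∷_; length; filter; head; last)
open import Data.List.Base using (allFin)
open import Data.List.Relation.Unary.All using (All)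
open import Data.List.Relation.Unary.Linked using (Linked)
open import Data.List.Relation.Unary.Unique.Propositional using (Unique)
open import Data.Maybe using (just)
open import Data.Product using (Σ; ∃; _×_; _,_)
open import Data.Sum using (_⊎_; inj₁; inj₂)
open import Relation.Binary.PropositionalEquality using (_≡_)
open import Relation.Nullary using (¬_)

record Graph (N : ℕ) : Set₁ where
  field
    Adj   : Fin N → Fin N → Set
    sym   : ∀ {u v} → Adj u v → Adj v u
    irrefl : ∀ {u} → ¬ Adj u u

open Graph public

-- K_{n,n}: vertices Fin (n + n); vertices with index < n form one side,
-- the others form the other side; u ~ v iff they lie on different sides.
Side : ∀ {N} → ℕ → Fin N → Set
Side n u = toℕ u < n

KAdj : (n : ℕ) → Fin (n + n) → Fin (n + n) → Set
KAdj n u v = (Side n u × ¬ Side n v) ⊎ (¬ Side n u × Side n v)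

K : (n : ℕ) → Graph (n + n)
K n = record { Adj = KAdj n ; sym = sy ; irrefl = ir }
  where
  sy : ∀ {u v} → KAdj n u v → KAdj n v u
  sy (inj₁ (a , b)) = inj₂ (b , a)
  sy (inj₂ (a , b)) = inj₁ (b , a)
  ir : ∀ {u} → ¬ KAdj n u u
  ir (inj₁ (a , b)) = b a
  ir (inj₂ (a , b)) = a b

-- A t-coloring (not necessarily surjective); colors are Fin t.
Coloring : ℕ → ℕ → Set
Coloring N t = Fin N → Fin t

classSize : ∀ {N t} → Coloring N t → Fin t → ℕ
classSize {N} f j = length (filter (λ v → f v ≟ j) (allFin N))

Equitable : ∀ {N t} → Coloring N t → Set
Equitable f = ∀ j l → classSize f j ≤ classSize f l + 1

module _ {N t : ℕ} (G : Graph N) (f : Coloring N t) where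

  AdjIn : Fin t → Fin N → Fin N → Set
  AdjIn j u v = f u ≡ j × f v ≡ j × Adj G u v

  data Conn (j : Fin t) : Fin N → Fin N → Set where
    here : ∀ {u} → f u ≡ j → Conn j u u
    step : ∀ {u v w} → AdjIn j u v → Conn j v w → Conn j u w

  record Cycle (j : Fin t) : Set where
    field
      verts    : List (Fin N)
      long     : length verts ≥ 3
      distinct : Unique verts
      inClass  : All (λ v → f v ≡ j) verts
      path     : Linked (Adj G) verts
      closing  : ∀ {a b} → head verts ≡ just a → last verts ≡ just b → Adj G b a

  Dist≤2 : Fin t → Fin N → Fin N → Set
  Dist≤2 j u v = u ≡ v ⊎ AdjIn j u v ⊎ ∃ λ w → AdjIn j u w × AdjIn j w v

  -- (t,∞,2)-tree-coloring: every component of every G[V_j] is a tree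
  -- (connected by definition of component, and acyclic) of diameter ≤ 2
  TreeColoring₂ : Set
  TreeColoring₂ = ∀ j → ¬ Cycle j × (∀ u v → Conn j u v → Dist≤2 j u v)

-- By equitability every colour class has the average size t + i = 2n / t.  A class
-- meeting both sides of K_{n,n} in two vertices contains a 4-cycle, so each class
-- has at most one vertex on some side and hence at least t + i - 1 on the other.
-- As t is odd, more than t / 2 classes are heavy on the same side, and that side
-- would need (t + 1) / 2 · (t + i - 1) > n vertices.
module Submission where

open import Defs hiding (sym)
open import Data.Bool using (true; false; if_then_else_)
open import Data.Fin using (Fin; zero; suc; toℕ; _↑ˡ_; _↑ʳ_; _≟_)
open import Data.Fin.Properties using (toℕ-↑ˡ; toℕ-↑ʳ; ↑ˡ-injective; ↑ʳ-injective; toℕ<n)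
open import Data.List using (List; []; _∷_; length; filter; tabulate; allFin)
open import Data.List.Relation.Unary.All using (All; []; _∷_)
open import Data.List.Relation.Unary.All.Properties using (all-filter)
open import Data.List.Relation.Unary.AllPairs using ([]; _∷_)
open import Data.List.Relation.Unary.Linked using ([-]; _∷_)
open import Data.List.Relation.Unary.Unique.Propositional using (Unique)
open import Data.List.Relation.Unary.Unique.Propositional.Properties using (allFin⁺; filter⁺)
open import Data.Nat using (ℕ; zero; suc; _+_; _*_; _≤_; _<_; _≥_; _≤?_; s≤s; z≤n; s≤s⁻¹; z<s)
open import Data.Nat.Properties
  using (+-0-commutativeMonoid; +-assoc; +-comm; +-identityʳ; +-suc; *-identityʳ; module ≤-Reasoning;
         ≤-reflexive; ≤-trans; <-irrefl; <⇒≱; ≮⇒≥; ≰⇒>; m≤n+m; m<m+n; m+n≮m;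
         +-mono-≤; +-monoˡ-≤; +-monoʳ-≤; +-mono-<-≤; +-mono-≤-<; +-cancelˡ-≤; *-monoˡ-≤; *-cancelˡ-<)
open import Data.Nat.Solver using (module +-*-Solver)
open import Data.Product using (Σ; ∃; ∃₂; _×_; _,_; proj₁)
open import Data.Sum using (_⊎_; inj₁; inj₂; [_,_]′)
open import Function using (_∘_)
open import Relation.Binary.PropositionalEquality
open import Relation.Nullary using (¬_; Dec; does; yes; no; contradiction)
open import Relation.Unary using (Pred; Decidable)

open import Algebra.Properties.CommutativeMonoid.Sum +-0-commutativeMonoid
  using (sum-syntax; sum-cong-≗; sum-replicate-zero; ∑-comm)

indicator : ∀ {a} {A : Set a} → Dec A → ℕ
indicator d = if does d then 1 else 0

∑-const : ∀ n c → ∑[ i < n ] c ≡ n * c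
∑-const zero    c = refl
∑-const (suc n) c = cong (c +_) (∑-const n c)

∑-mono-≤ : ∀ {n} {f g : Fin n → ℕ} → (∀ i → f i ≤ g i) → ∑[ i < n ] f i ≤ ∑[ i < n ] g i
∑-mono-≤ {zero}  f≤g = z≤n
∑-mono-≤ {suc n} f≤g = +-mono-≤ (f≤g zero) (∑-mono-≤ (f≤g ∘ suc))

∑-mono-< : ∀ {n} {f g : Fin n → ℕ} j → (∀ i → f i ≤ g i) → f j < g j →
           ∑[ i < n ] f i < ∑[ i < n ] g i
∑-mono-< zero    f≤g fj<gj = +-mono-<-≤ fj<gj (∑-mono-≤ (f≤g ∘ suc))
∑-mono-< (suc j) f≤g fj<gj = +-mono-≤-< (f≤g zero) (∑-mono-< j (f≤g ∘ suc) fj<gj)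

∑-split : ∀ m {k} (g : Fin (m + k) → ℕ) →
          ∑[ v < m + k ] g v ≡ ∑[ x < m ] g (x ↑ˡ k) + ∑[ y < k ] g (m ↑ʳ y)
∑-split zero    g = refl
∑-split (suc m) g = trans (cong (g zero +_) (∑-split m (g ∘ suc))) (sym (+-assoc (g zero) _ _))

∑-indicator-≟ : ∀ {t} (c : Fin t) → ∑[ j < t ] indicator (c ≟ j) ≡ 1
∑-indicator-≟ {suc t} zero    = cong suc (sum-replicate-zero t)
∑-indicator-≟ {suc t} (suc c) = ∑-indicator-≟ c

length-filter-tabulate : ∀ {a p} {A : Set a} {P : Pred A p} (P? : Decidable P) {N} (g : Fin N → A) →
                         length (filter P? (tabulate g)) ≡ ∑[ i < N ] indicator (P? (g i))
length-filter-tabulate P? {zero}  g = refl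
length-filter-tabulate P? {suc N} g with does (P? (g zero))
... | true  = cong suc (length-filter-tabulate P? (g ∘ suc))
... | false = length-filter-tabulate P? (g ∘ suc)

two-distinct : ∀ {a p} {A : Set a} {P : Pred A p} {xs : List A} →
               2 ≤ length xs → Unique xs → All P xs → ∃₂ λ u v → u ≢ v × P u × P v
two-distinct {xs = []}        ()       _               _
two-distinct {xs = _ ∷ []}    (s≤s ()) _               _
two-distinct {xs = u ∷ v ∷ _} _        ((u≢v ∷ _) ∷ _) (pu ∷ pv ∷ _) = u , v , u≢v , pu , pv

module _ {N t : ℕ} (f : Coloring N t) where

  classSize≡∑ : ∀ j → classSize f j ≡ ∑[ v < N ] indicator (f v ≟ j)
  classSize≡∑ j = length-filter-tabulate (λ v → f v ≟ j) (λ v → v)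

  ∑-classSize : ∑[ j < t ] classSize f j ≡ N
  ∑-classSize = begin
    ∑[ j < t ] classSize f j                   ≡⟨ sum-cong-≗ classSize≡∑ ⟩
    ∑[ j < t ] ∑[ v < N ] indicator (f v ≟ j)  ≡⟨ ∑-comm (λ j v → indicator (f v ≟ j)) ⟩
    ∑[ v < N ] ∑[ j < t ] indicator (f v ≟ j)  ≡⟨ sum-cong-≗ (∑-indicator-≟ ∘ f) ⟩
    ∑[ v < N ] 1                               ≡⟨ ∑-const N 1 ⟩
    N * 1                                      ≡⟨ *-identityʳ N ⟩
    N                                          ∎
    where open ≡-Reasoning

  classSize≥2⇒distinct : ∀ j → 2 ≤ classSize f j → ∃₂ λ u v → u ≢ v × f u ≡ j × f v ≡ j
  classSize≥2⇒distinct j size≥2 =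
    two-distinct size≥2 (filter⁺ (λ v → f v ≟ j) (allFin⁺ N)) (all-filter (λ v → f v ≟ j) (allFin N))

  classSize-≥-average : ∀ {s} → Equitable f → N ≡ t * s → ∀ j → s ≤ classSize f j
  classSize-≥-average {s} equitable N≡ts j = ≮⇒≥ (λ small → <-irrefl refl (total-too-small small))
    where
    open ≤-Reasoning
    total-too-small : classSize f j < s → N < N
    total-too-small small = begin-strict
      N                         ≡⟨ ∑-classSize ⟨
      ∑[ l < t ] classSize f l  <⟨ ∑-mono-< j bounded small ⟩
      ∑[ l < t ] s              ≡⟨ ∑-const t s ⟩
      t * s                     ≡⟨ N≡ts ⟨
      N                         ∎
      where
      bounded : ∀ l → classSize f l ≤ s
      bounded l = ≤-trans (equitable l j) (≤-trans (≤-reflexive (+-comm _ 1)) small)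

module _ {m k t : ℕ} (f : Coloring (m + k) t) where

  classSize-split : ∀ j → classSize f j ≡ classSize (f ∘ (_↑ˡ k)) j + classSize (f ∘ (m ↑ʳ_)) j
  classSize-split j = begin
    classSize f j                                   ≡⟨ classSize≡∑ f j ⟩
    ∑[ v < m + k ] indicator (f v ≟ j)              ≡⟨ ∑-split m (λ v → indicator (f v ≟ j)) ⟩
    ∑[ x < m ] indicator (f (x ↑ˡ k) ≟ j)
      + ∑[ y < k ] indicator (f (m ↑ʳ y) ≟ j)       ≡⟨ cong₂ _+_ (classSize≡∑ left j) (classSize≡∑ right j) ⟨
    classSize left j + classSize right j            ∎
    where
    open ≡-Reasoning
    left : Coloring m t
    left  = f ∘ (_↑ˡ k)
    right : Coloring k t
    right = f ∘ (m ↑ʳ_)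

one-side-heavy : ∀ {m a b} → suc m ≤ a + b → a ≤ 1 ⊎ b ≤ 1 → m ≤ a ⊎ m ≤ b
one-side-heavy {b = b} m<a+b (inj₁ a≤1) = inj₂ (s≤s⁻¹ (≤-trans m<a+b (+-monoˡ-≤ b a≤1)))
one-side-heavy {a = a} m<a+b (inj₂ b≤1) =
  inj₁ (s≤s⁻¹ (≤-trans m<a+b (≤-trans (+-monoʳ-≤ a b≤1) (≤-reflexive (+-comm a 1)))))

∑-lower-bound-⊎ : ∀ {t} m (a b : Fin t → ℕ) → (∀ j → m ≤ a j ⊎ m ≤ b j) →
                  ∃₂ λ p q → p + q ≡ t × p * m ≤ ∑[ j < t ] a j × q * m ≤ ∑[ j < t ] b j
∑-lower-bound-⊎ {zero}  m a b heavy = 0 , 0 , refl , z≤n , z≤n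
∑-lower-bound-⊎ {suc t} m a b heavy
  with ∑-lower-bound-⊎ m (a ∘ suc) (b ∘ suc) (heavy ∘ suc) | heavy zero
... | p , q , p+q≡t , pm≤ , qm≤ | inj₁ m≤a₀ =
  suc p , q , cong suc p+q≡t , +-mono-≤ m≤a₀ pm≤ , ≤-trans qm≤ (m≤n+m _ (b zero))
... | p , q , p+q≡t , pm≤ , qm≤ | inj₂ m≤b₀ =
  p , suc q , trans (+-suc p q) (cong suc p+q≡t) , ≤-trans pm≤ (m≤n+m _ (a zero)) , +-mono-≤ m≤b₀ qm≤

odd-split : ∀ {p q} k → p + q ≡ 2 * k + 1 → suc k ≤ p ⊎ suc k ≤ q
odd-split {p} {q} k p+q≡t with suc k ≤? p
... | yes k<p = inj₁ k<p
... | no  k≮p = inj₂ (+-cancelˡ-≤ k _ _ (begin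
  k + suc k  ≡⟨ solve 1 (λ k → k :+ (con 1 :+ k) := con 2 :* k :+ con 1) refl k ⟩
  2 * k + 1  ≡⟨ p+q≡t ⟨
  p + q      ≤⟨ +-monoˡ-≤ q (s≤s⁻¹ (≰⇒> k≮p)) ⟩
  k + q      ∎))
  where open ≤-Reasoning
        open +-*-Solver

odd-majority : ∀ {k} m (a b : Fin (2 * k + 1) → ℕ) → (∀ j → m ≤ a j ⊎ m ≤ b j) →
               suc k * m ≤ ∑[ j < 2 * k + 1 ] a j ⊎ suc k * m ≤ ∑[ j < 2 * k + 1 ] b j
odd-majority {k} m a b heavy with ∑-lower-bound-⊎ m a b heavy
... | p , q , p+q≡t , pm≤ , qm≤ with odd-split {p} {q} k p+q≡t
...   | inj₁ k<p = inj₁ (≤-trans (*-monoˡ-≤ m k<p) pm≤)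
...   | inj₂ k<q = inj₂ (≤-trans (*-monoˡ-≤ m k<q) qm≤)

half-classes-overflow : ∀ k r n → 2 * n ≡ (2 * k + 1) * (2 * k + 1 + suc (suc r)) →
                        n < suc k * (2 * k + 1 + suc r)
half-classes-overflow k r n 2n≡ = *-cancelˡ-< 2 _ _ (begin-strict
  2 * n                                                      ≡⟨ 2n≡ ⟩
  (2 * k + 1) * (2 * k + 1 + suc (suc r))                    <⟨ m<m+n _ z<s ⟩
  (2 * k + 1) * (2 * k + 1 + suc (suc r)) + suc r            ≡⟨ identity ⟩
  2 * (suc k * (2 * k + 1 + suc r))                          ∎)
  where
  open ≤-Reasoning
  open +-*-Solver
  identity : (2 * k + 1) * (2 * k + 1 + suc (suc r)) + suc r ≡ 2 * (suc k * (2 * k + 1 + suc r))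
  identity = solve 2 (λ k r → (con 2 :* k :+ con 1) :* (con 2 :* k :+ con 1 :+ (con 2 :+ r)) :+ (con 1 :+ r)
                           := con 2 :* ((con 1 :+ k) :* (con 2 :* k :+ con 1 :+ (con 1 :+ r)))) refl k r

module _ {n : ℕ} where

  left-Side : (x : Fin n) → Side n (x ↑ˡ n)
  left-Side x = subst (_< n) (sym (toℕ-↑ˡ x n)) (toℕ<n x)

  right-¬Side : (y : Fin n) → ¬ Side n (n ↑ʳ y)
  right-¬Side y y<n = m+n≮m n (toℕ y) (subst (_< n) (toℕ-↑ʳ n y) y<n)

  KAdj-↑ˡ-↑ʳ : (x y : Fin n) → KAdj n (x ↑ˡ n) (n ↑ʳ y)
  KAdj-↑ˡ-↑ʳ x y = inj₁ (left-Side x , right-¬Side y)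

  KAdj-↑ʳ-↑ˡ : (y x : Fin n) → KAdj n (n ↑ʳ y) (x ↑ˡ n)
  KAdj-↑ʳ-↑ˡ y x = inj₂ (right-¬Side y , left-Side x)

  ↑ˡ≢↑ʳ : (x y : Fin n) → x ↑ˡ n ≢ n ↑ʳ y
  ↑ˡ≢↑ʳ x y x≡y = right-¬Side y (subst (Side n) x≡y (left-Side x))

  module _ {t : ℕ} (f : Coloring (n + n) t) (j : Fin t) where

    K-square : ∀ {x₁ x₂ y₁ y₂ : Fin n} → x₁ ≢ x₂ → y₁ ≢ y₂ →
               f (x₁ ↑ˡ n) ≡ j → f (x₂ ↑ˡ n) ≡ j → f (n ↑ʳ y₁) ≡ j → f (n ↑ʳ y₂) ≡ j →
               Cycle (K n) f j
    K-square {x₁} {x₂} {y₁} {y₂} x₁≢x₂ y₁≢y₂ fx₁ fx₂ fy₁ fy₂ = record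
      { verts    = (x₁ ↑ˡ n) ∷ (n ↑ʳ y₁) ∷ (x₂ ↑ˡ n) ∷ (n ↑ʳ y₂) ∷ []
      ; long     = s≤s (s≤s (s≤s z≤n))
      ; distinct = (↑ˡ≢↑ʳ x₁ y₁ ∷ x₁≢x₂ ∘ ↑ˡ-injective n x₁ x₂ ∷ ↑ˡ≢↑ʳ x₁ y₂ ∷ [])
                 ∷ (≢-sym (↑ˡ≢↑ʳ x₂ y₁) ∷ y₁≢y₂ ∘ ↑ʳ-injective n y₁ y₂ ∷ [])
                 ∷ (↑ˡ≢↑ʳ x₂ y₂ ∷ [])
                 ∷ [] ∷ []
      ; inClass  = fx₁ ∷ fy₁ ∷ fx₂ ∷ fy₂ ∷ []
      ; path     = KAdj-↑ˡ-↑ʳ x₁ y₁ ∷ KAdj-↑ʳ-↑ˡ y₁ x₂ ∷ KAdj-↑ˡ-↑ʳ x₂ y₂ ∷ [-]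
      ; closing  = λ { refl refl → KAdj-↑ʳ-↑ˡ y₂ x₁ }
      }

    acyclic⇒thin-side : ¬ Cycle (K n) f j →
                        classSize (f ∘ (_↑ˡ n)) j ≤ 1 ⊎ classSize (f ∘ (n ↑ʳ_)) j ≤ 1
    acyclic⇒thin-side acyclic with classSize (f ∘ (_↑ˡ n)) j ≤? 1 | classSize (f ∘ (n ↑ʳ_)) j ≤? 1
    ... | yes left≤1 | _           = inj₁ left≤1
    ... | no  _      | yes right≤1 = inj₂ right≤1
    ... | no  left≰1 | no  right≰1
      with classSize≥2⇒distinct (f ∘ (_↑ˡ n)) j (≰⇒> left≰1)
         | classSize≥2⇒distinct (f ∘ (n ↑ʳ_)) j (≰⇒> right≰1)
    ...   | _ , _ , x₁≢x₂ , fx₁ , fx₂ | _ , _ , y₁≢y₂ , fy₁ , fy₂ =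
      contradiction (K-square x₁≢x₂ y₁≢y₂ fx₁ fx₂ fy₁ fy₂) acyclic

lemma2p5 : (t i n : ℕ) → t ≥ 1 → (∃ λ k → t ≡ 2 * k + 1) → i ≥ 2 → 2 * n ≡ t * (t + i) →
    ¬ (Σ (Coloring (n + n) t) λ f → Equitable f × TreeColoring₂ (K n) f)
lemma2p5 .(2 * k + 1) .(suc (suc r)) n _ (k , refl) (s≤s (s≤s (z≤n {r}))) 2n≡ (f , equitable , tree) =
  [ overflow left , overflow right ]′ (odd-majority {k} m (classSize left) (classSize right) heavy)
  where
  t m : ℕ
  t = 2 * k + 1
  m = t + suc r

  left right : Coloring n t
  left  = f ∘ (_↑ˡ n)
  right = f ∘ (n ↑ʳ_)

  classes-large : ∀ j → t + suc (suc r) ≤ classSize f j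
  classes-large = classSize-≥-average f equitable (trans (cong (n +_) (sym (+-identityʳ n))) 2n≡)

  heavy : ∀ j → m ≤ classSize left j ⊎ m ≤ classSize right j
  heavy j = one-side-heavy (subst₂ _≤_ (+-suc t (suc r)) (classSize-split {n} {n} f j) (classes-large j))
                           (acyclic⇒thin-side {n} f j (proj₁ (tree j)))

  overflow : (g : Coloring n t) → ¬ suc k * m ≤ ∑[ j < t ] classSize g j
  overflow g bound = <⇒≱ (half-classes-overflow k r n 2n≡) (≤-trans bound (≤-reflexive (∑-classSize g)))
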